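{- Let $\mathcal{M}$ be an $n$-maniplex, let $0\le i_1<i_2<\dots<i_k\le n-1$, and set $i_0:=-1$ and $i_{k+1}:=n$. Let $F$ be a connected component of $\mathcal{M}_{[n]\setminus\{i_1,\dots,i_k\}}$ and let $u,v\in F$. Then there exist flags $u=w_0,w_1,\dots,w_{k+1}=v$ in $F$ such that for each $j=0,\dots,k$ there is a path from $w_j$ to $w_{j+1}$ all of whose edges have colours greater than $i_j$ and smaller than $i_{j+1}$.
   Context: Write $[n]=\{0,1,\dots,n-1\}$. An $n$-maniplex is a simple graph $\mathcal{M}$ whose edges are coloured with colours from $[n]$ so that every vertex (called a flag) is incident to exactly one edge of each colour, and such that for all $i,j\in[n]$ with $|i-j|>1$, every connected component of the subgraph formed by all vertices and the edges of colours $i$ and $j$ is a $4$-cycle. For $A\subset[n]$, $\mathcal{M}_A$ denotes the spanning subgraph of $\mathcal{M}$ containing exactly the edges with colours in $A$. Paths may have length zero. -}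

module Defs where

open import Level using (Level; suc; _⊔_)
open import Data.Nat as ℕ using (ℕ; _<?_)
open import Data.Fin as Fin using (Fin; toℕ; fromℕ<; inject₁)
open import Data.Integer as ℤ using (ℤ; +_; -1ℤ)
open import Data.Product using (_×_)
open import Relation.Binary.PropositionalEquality using (_≡_; _≢_)
open import Relation.Nullary using (yes; no)

-- An n-maniplex, presented by its flags and, for each colour i ∈ [n] = Fin n,
-- the map r i sending a flag to its unique i-neighbour (the other end of the
-- unique i-coloured edge at that flag).
record Maniplex (n : ℕ) (ℓ : Level) : Set (Level.suc ℓ) where
  field
    Flag : Set ℓ
    r    : Fin n → Flag → Flag
    r-invol   : ∀ i x → r i (r i x) ≡ x
    r-noloop  : ∀ i x → r i x ≢ x
    r-simple  : ∀ i j x → i ≢ j → r i x ≢ r j x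
    -- for |i - j| > 1, the {i,j}-component of every flag x is a 4-cycle
    -- x – r i x – r j (r i x) = r i (r j x) – r j x – x, with four distinct flags
    fourCycle : ∀ i j x → 1 ℕ.< ℕ.∣ toℕ i - toℕ j ∣ →
                  (r j (r i x) ≡ r i (r j x))
                × (x ≢ r i x) × (x ≢ r j x) × (x ≢ r j (r i x))
                × (r i x ≢ r j x) × (r i x ≢ r j (r i x)) × (r j x ≢ r j (r i x))

module _ {n : ℕ} {ℓ : Level} (M : Maniplex n ℓ) where
  open Maniplex M

  data Path (P : Fin n → Set) : Flag → Flag → Set ℓ where
    here : ∀ {x} → Path P x x
    step : ∀ {x y} (c : Fin n) → P c → Path P (r c x) y → Path P x y

-- Colours of M_{[n] ∖ {i_1,…,i_k}}, where the i's are given by ι : Fin k → Fin n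
NotIn : {n k : ℕ} → (Fin k → Fin n) → Fin n → Set
NotIn ι c = ∀ j → ι j ≢ c

-- Strictly increasing sequence i_1 < … < i_k (ι a = i_{a+1})
StrictlyIncreasing : {n k : ℕ} → (Fin k → Fin n) → Set
StrictlyIncreasing ι = ∀ a b → a Fin.< b → ι a Fin.< ι b

-- The extended sequence i_0 = -1, i_1, …, i_k, i_{k+1} = n (indices 0..k+1)
bound : {n k : ℕ} → (Fin k → Fin n) → Fin (2 ℕ.+ k) → ℤ
bound ι Fin.zero = -1ℤ
bound {n} {k} ι (Fin.suc j) with toℕ j <? k
... | yes p = + toℕ (ι (fromℕ< p))
... | no _  = + n

Between : {n k : ℕ} → (Fin k → Fin n) → Fin (ℕ.suc k) → Fin n → Set
Between ι j c = (bound ι (inject₁ j) ℤ.< + toℕ c) × (+ toℕ c ℤ.< bound ι (Fin.suc j))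

-- Induct on the path from u to v.  If its first edge has colour c, then c lies
-- strictly between two consecutive thresholds i_b < c < i_{b+1}, and a
-- decomposition w′ for the rest of the path (from r c u to v) is pulled back
-- along the c-edge: the flags w′_0, …, w′_b are replaced by their c-neighbours,
-- the segment from w′_b gains the c-edge at its start, and each earlier segment
-- is transported by r c.  The transport is legitimate because every colour of
-- an earlier block is at distance ≥ 2 from c, so the 4-cycle axiom makes its
-- edges commute with the c-edges.
module Submission where

open import Defs
open import Level using (Level)
open import Data.Nat using (ℕ; suc)
open import Data.Fin using (Fin; zero; fromℕ; inject₁)
open import Data.Product using (Σ; _×_)
open import Relation.Binary.PropositionalEquality using (_≡_)

open import Data.Nat as ℕ using (z≤n; s≤s)
import Data.Nat.Properties as ℕ
open import Data.Fin as Fin using (toℕ; _≤?_)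
open import Data.Fin.Properties as Fin
  using (toℕ-injective; toℕ<n; toℕ-fromℕ; toℕ-fromℕ<; toℕ-inject₁; ≤fromℕ)
open import Data.Fin.Relation.Unary.Top using (view; ‵fromℕ; ‵inject₁)
open import Data.Integer as ℤ using (ℤ; +_; +<+; -<+)
import Data.Integer.Properties as ℤ
open import Data.Product using (_,_; proj₁)
open import Data.Sum using (inj₁; inj₂)
open import Function using (_∘_)
open import Relation.Binary using (_Preserves_⟶_; tri<; tri≈; tri>)
open import Relation.Binary.PropositionalEquality using (_≢_; refl; sym; trans; cong; subst; subst₂)
open import Relation.Nullary using (¬_; yes; no; contradiction)

1<∣m-n∣ : ∀ {m n} → suc m ℕ.< n → 1 ℕ.< ℕ.∣ m - n ∣
1<∣m-n∣ {ℕ.zero} 1<n = 1<n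
1<∣m-n∣ {suc m} {suc n} (s≤s 1+m<n) = 1<∣m-n∣ 1+m<n

+<+<+⇒1+< : ∀ {m n z} → + m ℤ.< z → z ℤ.< + n → suc m ℕ.< n
+<+<+⇒1+< (+<+ m<z) (+<+ z<n) = ℕ.≤-<-trans m<z z<n

≤⇒inject₁≤ : ∀ {m n} {i : Fin m} {j : Fin n} → i Fin.≤ j → inject₁ i Fin.≤ j
≤⇒inject₁≤ {i = i} = subst (ℕ._≤ _) (sym (toℕ-inject₁ i))

inject₁≤⇒≤ : ∀ {m n} {i : Fin m} {j : Fin n} → inject₁ i Fin.≤ j → i Fin.≤ j
inject₁≤⇒≤ {i = i} = subst (ℕ._≤ _) (toℕ-inject₁ i)

<⇒suc≤inject₁ : ∀ {m n} {i : Fin m} {j : Fin n} → i Fin.< j → Fin.suc i Fin.≤ inject₁ j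
<⇒suc≤inject₁ {j = j} = subst (_ ℕ.≤_) (sym (toℕ-inject₁ j))

-- Between ι j c unfolds to Block (bound ι) j (+ toℕ c).
Block : ∀ {m} → (Fin (suc (suc m)) → ℤ) → Fin (suc m) → ℤ → Set
Block f j x = f (inject₁ j) ℤ.< x × x ℤ.< f (Fin.suc j)

block-exists : ∀ {m} (f : Fin (suc (suc m)) → ℤ) {x} →
               f zero ℤ.< x → x ℤ.< f (fromℕ (suc m)) →
               (∀ i → f (Fin.suc (inject₁ i)) ≢ x) →
               Σ (Fin (suc m)) λ j → Block f j x
block-exists {ℕ.zero} f f₀<x x<f₁ _ = zero , f₀<x , x<f₁
block-exists {suc m} f {x} f₀<x x<fₗ f≢x with x ℤ.<? f (Fin.suc zero)
... | yes x<f₁ = zero , f₀<x , x<f₁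
... | no  x≮f₁ with block-exists (f ∘ Fin.suc) (ℤ.≤∧≢⇒< (ℤ.≮⇒≥ x≮f₁) (f≢x zero)) x<fₗ (f≢x ∘ Fin.suc)
...   | j , x∈j = Fin.suc j , x∈j

module _ {m} {f : Fin (suc (suc m)) → ℤ} (f-strict : f Preserves Fin._<_ ⟶ ℤ._<_) where

  strict⇒mono : f Preserves Fin._≤_ ⟶ ℤ._≤_
  strict⇒mono a≤b with ℕ.m≤n⇒m<n∨m≡n a≤b
  ... | inj₁ a<b = ℤ.<⇒≤ (f-strict a<b)
  ... | inj₂ a≡b = ℤ.≤-reflexive (cong f (toℕ-injective a≡b))

  block-separated : ∀ {j j′ x y} → j Fin.< j′ → Block f j x → Block f j′ y →
                    x ℤ.< f (Fin.suc j) × f (Fin.suc j) ℤ.< y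
  block-separated {j′ = j′} j<j′ (_ , x<fⱼ₊₁) (fⱼ′<y , _) =
    x<fⱼ₊₁ , ℤ.≤-<-trans (strict⇒mono (<⇒suc≤inject₁ {j = j′} j<j′)) fⱼ′<y

module _ {n k : ℕ} (ι : Fin k → Fin n) where

  bound-inject₁ : ∀ a → bound ι (Fin.suc (inject₁ a)) ≡ + toℕ (ι a)
  bound-inject₁ a with toℕ (inject₁ a) ℕ.<? k
  ... | yes a<k = cong (+_ ∘ toℕ ∘ ι) (toℕ-injective (trans (toℕ-fromℕ< a<k) (toℕ-inject₁ a)))
  ... | no  a≮k = contradiction (Fin.inject₁ℕ< a) a≮k

  bound-last : bound ι (fromℕ (suc k)) ≡ + n
  bound-last with toℕ (fromℕ k) ℕ.<? k
  ... | yes k<k = contradiction k<k (ℕ.<-irrefl (toℕ-fromℕ k))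
  ... | no  _   = refl

  bound-strict : StrictlyIncreasing ι → bound ι Preserves Fin._<_ ⟶ ℤ._<_
  bound-strict ι-inc {zero} {Fin.suc j} _ with view j
  ... | ‵fromℕ     = subst (ℤ.-1ℤ ℤ.<_) (sym bound-last) -<+
  ... | ‵inject₁ b = subst (ℤ.-1ℤ ℤ.<_) (sym (bound-inject₁ b)) -<+
  bound-strict ι-inc {Fin.suc i} {Fin.suc j} (s≤s i<j) with view i | view j
  ... | ‵fromℕ     | _          = contradiction (≤fromℕ j) (ℕ.<⇒≱ i<j)
  ... | ‵inject₁ a | ‵fromℕ     =
    subst₂ ℤ._<_ (sym (bound-inject₁ a)) (sym bound-last) (+<+ (toℕ<n (ι a)))
  ... | ‵inject₁ a | ‵inject₁ b =
    subst₂ ℤ._<_ (sym (bound-inject₁ a)) (sym (bound-inject₁ b))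
      (+<+ (ι-inc a b (subst₂ ℕ._<_ (toℕ-inject₁ a) (toℕ-inject₁ b) i<j)))

  between-exists : (c : Fin n) → NotIn ι c → Σ (Fin (suc k)) λ j → Between ι j c
  between-exists c c∉ι =
    block-exists (bound ι) -<+ (subst (+ toℕ c ℤ.<_) (sym bound-last) (+<+ (toℕ<n c)))
      (λ a bound≡c → c∉ι a (toℕ-injective (ℤ.+-injective (trans (sym (bound-inject₁ a)) bound≡c))))

  between-separated : StrictlyIncreasing ι → ∀ {j j′ c d} → j Fin.< j′ →
                      Between ι j c → Between ι j′ d → 1 ℕ.< ℕ.∣ toℕ c - toℕ d ∣
  between-separated ι-inc j<j′ c∈j d∈j′
    with block-separated (bound-strict ι-inc) j<j′ c∈j d∈j′
  ... | c<bound , bound<d = 1<∣m-n∣ (+<+<+⇒1+< c<bound bound<d)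

module _ {n ℓ} (M : Maniplex n ℓ) where
  open Maniplex M

  _++ₚ_ : ∀ {P x y z} → Path M P x y → Path M P y z → Path M P x z
  here        ++ₚ q = q
  step c Pc p ++ₚ q = step c Pc (p ++ₚ q)

  r-commute : ∀ {i j} → 1 ℕ.< ℕ.∣ toℕ i - toℕ j ∣ → ∀ x → r i (r j x) ≡ r j (r i x)
  r-commute far x = sym (proj₁ (fourCycle _ _ x far))

  Path-conjugate : ∀ {P x y} c → (∀ {d} → P d → ∀ z → r d (r c z) ≡ r c (r d z)) →
                   Path M P x y → Path M P (r c x) (r c y)
  Path-conjugate c comm here = here
  Path-conjugate {P} {y = y} c comm (step {x} d Pd p) =
    step d Pd (subst (λ z → Path M P z (r c y)) (sym (comm Pd x)) (Path-conjugate c comm p))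

  module _ {k} (ι : Fin k → Fin n) (ι-inc : StrictlyIncreasing ι) where

    Decomposition : Flag → Flag → Set ℓ
    Decomposition u v = Σ (Fin (suc (suc k)) → Flag) λ w →
        (w zero ≡ u) × (w (fromℕ (suc k)) ≡ v)
      × (∀ j → Path M (NotIn ι) u (w j))
      × (∀ (j : Fin (suc k)) → Path M (Between ι j) (w (inject₁ j)) (w (Fin.suc j)))

    decomposition-refl : ∀ x → Decomposition x x
    decomposition-refl x = (λ _ → x) , refl , refl , (λ _ → here) , (λ _ → here)

    decomposition-cons : ∀ {x v b} c → NotIn ι c → Between ι b c →
                         Decomposition (r c x) v → Decomposition x v
    decomposition-cons {x} {v} {b} c c∉ι c∈b (w′ , w′₀ , w′ₗ , reach′ , seg′) =
      w , w₀ , wₗ , reach , seg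
      where
      w : Fin (suc (suc k)) → Flag
      w j with j ≤? b
      ... | yes _ = r c (w′ j)
      ... | no  _ = w′ j

      w-≤ : ∀ {j} → j Fin.≤ b → w j ≡ r c (w′ j)
      w-≤ {j} j≤b with j ≤? b
      ... | yes _   = refl
      ... | no  j≰b = contradiction j≤b j≰b

      w-≰ : ∀ {j} → ¬ j Fin.≤ b → w j ≡ w′ j
      w-≰ {j} j≰b with j ≤? b
      ... | yes j≤b = contradiction j≤b j≰b
      ... | no  _   = refl

      w₀ : w zero ≡ x
      w₀ = trans (w-≤ z≤n) (trans (cong (r c) w′₀) (r-invol c x))

      wₗ : w (fromℕ (suc k)) ≡ v
      wₗ = trans (w-≰ (ℕ.<⇒≱ (subst (toℕ b ℕ.<_) (sym (toℕ-fromℕ (suc k))) (toℕ<n b)))) w′ₗ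

      reach : ∀ j → Path M (NotIn ι) x (w j)
      reach j with j ≤? b
      ... | yes _ = step c c∉ι (reach′ j ++ₚ step c c∉ι here)
      ... | no  _ = step c c∉ι (reach′ j)

      seg : ∀ j → Path M (Between ι j) (w (inject₁ j)) (w (Fin.suc j))
      seg j with Fin.<-cmp j b
      ... | tri< j<b _ _ =
        subst₂ (Path M (Between ι j)) (sym (w-≤ (≤⇒inject₁≤ (ℕ.<⇒≤ j<b)))) (sym (w-≤ j<b))
          (Path-conjugate c (λ d∈j → r-commute (between-separated ι ι-inc j<b d∈j c∈b)) (seg′ j))
      ... | tri≈ _ refl _ =
        subst₂ (Path M (Between ι j)) (sym (w-≤ (≤⇒inject₁≤ ℕ.≤-refl))) (sym (w-≰ (ℕ.<-irrefl refl)))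
          (step c c∈b (subst (λ z → Path M (Between ι j) z (w′ (Fin.suc j))) (sym (r-invol c _)) (seg′ j)))
      ... | tri> _ _ b<j =
        subst₂ (Path M (Between ι j)) (sym (w-≰ (ℕ.<⇒≱ b<j ∘ inject₁≤⇒≤))) (sym (w-≰ (ℕ.<⇒≱ (ℕ.m<n⇒m<1+n b<j))))
          (seg′ j)

    decompose : ∀ {u v} → Path M (NotIn ι) u v → Decomposition u v
    decompose {u} here = decomposition-refl u
    decompose (step c c∉ι p) with between-exists ι c c∉ι
    ... | b , c∈b = decomposition-cons c c∉ι c∈b (decompose p)

lemma5p2 : {n : ℕ} {ℓ : Level} (M : Maniplex n ℓ) (k : ℕ) (ι : Fin k → Fin n) →
    StrictlyIncreasing ι →
    (u v : Maniplex.Flag M) → Path M (NotIn ι) u v →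
    Σ (Fin (suc (suc k)) → Maniplex.Flag M) λ w →
      (w zero ≡ u) × (w (fromℕ (suc k)) ≡ v)
      × (∀ j → Path M (NotIn ι) u (w j))
      × (∀ (j : Fin (suc k)) → Path M (Between ι j) (w (inject₁ j)) (w (Data.Fin.suc j)))
lemma5p2 M k ι ι-inc u v = decompose M ι ι-inc
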